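{- Let $G$ be a nontrivial cyclic group of order $n$ and $\Gamma(G)$ its generator graph. Then $\dim(\Gamma(G)) = n-1$ if $n$ is prime, and $\dim(\Gamma(G)) = n-2$ otherwise.
   Context: For a group $G$, the generator graph $\Gamma(G)$ is the simple undirected graph whose vertex set is the set of elements of $G$, in which two distinct elements $x,y$ are adjacent if and only if at least one of them generates $G$. For a connected graph $\Gamma$ and an ordered set $W=\{w_1,\dots,w_k\}\subseteq V(\Gamma)$, let $r(u\mid W) = (d_\Gamma(u,w_1),\dots,d_\Gamma(u,w_k))$ with $d_\Gamma$ the graph distance; $W$ is a resolving set if $r(u\mid W)\ne r(v\mid W)$ for all distinct $u,v$. The metric dimension $\dim(\Gamma)$ is the minimum cardinality of a resolving set. -}

module Defs where

open import Data.Nat using (ℕ; zero; suc; _+_; _*_; _≤_)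
open import Data.Fin using (Fin; toℕ)
open import Data.Fin.Subset using (Subset; _∈_; ∣_∣)
open import Data.Product using (Σ; ∃; _×_)
open import Data.Sum using (_⊎_)
open import Relation.Binary.PropositionalEquality using (_≡_; _≢_)

-- The cyclic group of order n is modelled as ℤ/nℤ with carrier Fin n
-- (element i represents the residue class of i), addition mod n.

Generates : (n : ℕ) → Fin n → Set
Generates n x = (y : Fin n) → ∃ λ k → ∃ λ q → k * toℕ x ≡ q * n + toℕ y

Adj : (n : ℕ) → Fin n → Fin n → Set
Adj n x y = x ≢ y × (Generates n x ⊎ Generates n y)

data Walk (n : ℕ) : Fin n → Fin n → ℕ → Set where
  here : ∀ {u} → Walk n u u zero
  step : ∀ {u w v k} → Adj n u w → Walk n w v k → Walk n u v (suc k)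

Dist : (n : ℕ) → Fin n → Fin n → ℕ → Set
Dist n u v d = Walk n u v d × (∀ k → Walk n u v k → d ≤ k)

Resolving : (n : ℕ) → Subset n → Set
Resolving n W = (u v : Fin n) → u ≢ v →
  ∃ λ w → w ∈ W × ∃ λ d₁ → ∃ λ d₂ → Dist n u w d₁ × Dist n v w d₂ × d₁ ≢ d₂

MetricDim : (n : ℕ) → ℕ → Set
MetricDim n m = (Σ (Subset n) λ W → Resolving n W × ∣ W ∣ ≡ m)
              × ((W : Subset n) → Resolving n W → m ≤ ∣ W ∣)

{-# OPTIONS --safe #-}
module Submission where

-- In Γ(ℤ/n) a generator is adjacent to every other vertex and two non-generators are never
-- adjacent. Hence any two generators, and any two non-generators, are twins, and no vertex
-- outside a twin pair lies at different distances from its two members: a resolving set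
-- misses at most one vertex of each kind, so dim ≥ n − 2. For prime n the graph is
-- complete, all vertices are twins and dim ≥ n − 1. Conversely every vertex is within
-- distance 2 of every other (through the generator 1), so a vertex resolves each pair
-- containing it: all vertices but 0 resolve, and when n has a proper divisor d, all
-- vertices but 0 and 1 resolve, d being at distance 2 from 0 and 1 from 1.

open import Defs
open import Data.Nat using (ℕ; zero; suc; _+_; _*_; _∸_; _≤_; _<_; z≤n; s≤s; s≤s⁻¹; NonTrivial)
open import Data.Nat.Properties using (≤-refl; ≤-trans; ≤-antisym; n≤1+n; +-comm; *-zeroʳ; *-identityʳ; *-assoc; m≤n+o⇒m∸n≤o)
  renaming (suc-injective to ℕ-suc-injective)
open import Data.Nat.Divisibility using (_∣_; ∣-refl; ∣-trans; n∣m*n; ∣m+n∣m⇒∣n; ∣1⇒≡1)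
open import Data.Nat.Coprimality using (Coprime; coprime?; coprime-Bézout; prime⇒coprime)
open import Data.Nat.GCD using (module Bézout)
open import Data.Nat.Primality using (Prime; composite; composite?; ¬composite⇒prime)
open import Data.Nat.Solver using (module +-*-Solver)
open import Data.Fin using (Fin; toℕ; fromℕ<; zero; suc)
open import Data.Fin.Properties using (_≟_; toℕ<n; toℕ-fromℕ<; 0≢1+n) renaming (suc-injective to Fin-suc-injective)
open import Data.Fin.Subset using (Subset; _∈_; _∉_; ∣_∣; ⊤; inside; outside)
open import Data.Fin.Subset.Properties using (_∈?_; ∈⊤; ∣⊤∣≡n; drop-there; p⊆q⇒∣p∣≤∣q∣)
open import Data.Vec using ([]; _∷_; here; there)
open import Data.Product using (∃; _×_; _,_; proj₁; proj₂)
open import Data.Sum using (_⊎_; inj₁; inj₂; [_,_]′) renaming (map to ⊎-map)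
open import Function using (_∘_; case_of_)
open import Relation.Nullary using (¬_; yes; no; contradiction)
open import Relation.Nullary.Decidable using (decidable-stable)
open import Relation.Unary using (Decidable)
open import Relation.Binary.PropositionalEquality using (_≡_; _≢_; refl; sym; trans; cong; subst; module ≡-Reasoning)

Resolves : (n : ℕ) → Subset n → Fin n → Fin n → Set
Resolves n W u v = ∃ λ w → w ∈ W × ∃ λ d₁ → ∃ λ d₂ → Dist n u w d₁ × Dist n v w d₂ × d₁ ≢ d₂

Connected : ℕ → Set
Connected n = (u v : Fin n) → ∃ (Dist n u v)

Nbrs⊆ : (n : ℕ) → Fin n → Fin n → Set
Nbrs⊆ n u v = ∀ x → x ≢ v → Adj n u x → Adj n v x

Twins : (n : ℕ) → Fin n → Fin n → Set
Twins n u v = Nbrs⊆ n u v × Nbrs⊆ n v u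

module _ {n : ℕ} where

  walk₀⇒≡ : {u v : Fin n} → Walk n u v 0 → u ≡ v
  walk₀⇒≡ here = refl

  dist-refl : {u : Fin n} → Dist n u u 0
  dist-refl = here , λ _ _ → z≤n

  adj⇒dist-1 : {u v : Fin n} → Adj n u v → Dist n u v 1
  adj⇒dist-1 u~v = step u~v here , λ where
    zero  w → contradiction (walk₀⇒≡ w) (proj₁ u~v)
    (suc k) _ → s≤s z≤n

  resolves-sym : {W : Subset n} {u v : Fin n} → Resolves n W u v → Resolves n W v u
  resolves-sym (w , w∈W , d₁ , d₂ , D₁ , D₂ , d₁≢d₂) = w , w∈W , d₂ , d₁ , D₂ , D₁ , d₁≢d₂ ∘ sym

  member-resolves : Connected n → {W : Subset n} {u v : Fin n} → u ∈ W → u ≢ v → Resolves n W u v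
  member-resolves connected {u = u} {v} u∈W u≢v with connected v u
  ... | zero  , D = contradiction (sym (walk₀⇒≡ (proj₁ D))) u≢v
  ... | suc d , D = u , u∈W , 0 , suc d , dist-refl , D , λ ()

  Nbrs⊆⇒shorter-walk : {u v w : Fin n} → Nbrs⊆ n u v → w ≢ u →
                       ∀ k → Walk n u w k → ∃ λ k′ → k′ ≤ k × Walk n v w k′
  Nbrs⊆⇒shorter-walk u⊆v w≢u zero here = contradiction refl w≢u
  Nbrs⊆⇒shorter-walk {v = v} u⊆v w≢u (suc k) (step {w = x} u~x walk) with x ≟ v
  ... | yes refl = k , n≤1+n k , walk
  ... | no x≢v   = suc k , ≤-refl , step (u⊆v x x≢v u~x) walk

  twins⇒equidistant : {u v w : Fin n} {d₁ d₂ : ℕ} → Twins n u v → w ≢ u → w ≢ v →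
                      Dist n u w d₁ → Dist n v w d₂ → d₁ ≡ d₂
  twins⇒equidistant (u⊆v , v⊆u) w≢u w≢v (walk₁ , min₁) (walk₂ , min₂)
    with Nbrs⊆⇒shorter-walk u⊆v w≢u _ walk₁ | Nbrs⊆⇒shorter-walk v⊆u w≢v _ walk₂
  ... | k₁ , k₁≤d₁ , walk₁′ | k₂ , k₂≤d₂ , walk₂′ =
    ≤-antisym (≤-trans (min₁ k₂ walk₂′) k₂≤d₂) (≤-trans (min₂ k₁ walk₁′) k₁≤d₁)

  resolving-twins-∉⇒≡ : {W : Subset n} → Resolving n W → {u v : Fin n} →
                        Twins n u v → u ∉ W → v ∉ W → u ≡ v
  resolving-twins-∉⇒≡ resolving {u} {v} twins u∉W v∉W with u ≟ v
  ... | yes u≡v = u≡v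
  ... | no u≢v with resolving u v u≢v
  ...   | w , w∈W , _ , _ , D₁ , D₂ , d₁≢d₂ =
    contradiction (twins⇒equidistant twins (λ { refl → u∉W w∈W }) (λ { refl → v∉W w∈W }) D₁ D₂)
                  d₁≢d₂

  complete⇒Nbrs⊆ : (∀ {x y} → x ≢ y → Adj n x y) → {u v : Fin n} → Nbrs⊆ n u v
  complete⇒Nbrs⊆ complete x x≢v _ = complete (x≢v ∘ sym)

  generates⇒Nbrs⊆ : {u v : Fin n} → Generates n v → Nbrs⊆ n u v
  generates⇒Nbrs⊆ gen-v x x≢v _ = x≢v ∘ sym , inj₁ gen-v

  ¬generates⇒Nbrs⊆ : {u v : Fin n} → ¬ Generates n u → Nbrs⊆ n u v
  ¬generates⇒Nbrs⊆ ¬gen-u x x≢v (_ , inj₁ gen-u) = contradiction gen-u ¬gen-u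
  ¬generates⇒Nbrs⊆ ¬gen-u x x≢v (_ , inj₂ gen-x) = x≢v ∘ sym , inj₂ gen-x

outside∷⊤-resolving : ∀ {n} → Connected (suc n) → Resolving (suc n) (outside ∷ ⊤)
outside∷⊤-resolving connected (suc i) v       u≢v = member-resolves connected (there ∈⊤) u≢v
outside∷⊤-resolving connected zero    (suc j) u≢v =
  resolves-sym (member-resolves connected (there ∈⊤) (u≢v ∘ sym))
outside∷⊤-resolving connected zero    zero    u≢v = contradiction refl u≢v

two-of-three : ∀ {a p r} {A : Set a} {P : A → Set p} → Decidable P → (R : A → A → Set r) →
               (∀ {x y} → P x → P y → R x y) → (∀ {x y} → ¬ P x → ¬ P y → R x y) →
               ∀ x y z → R x y ⊎ R x z ⊎ R y z
two-of-three P? R both neither x y z with P? x | P? y | P? z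
... | yes px | yes py | _      = inj₁ (both px py)
... | no ¬px | no ¬py | _      = inj₁ (neither ¬px ¬py)
... | yes px | no ¬py | yes pz = inj₂ (inj₁ (both px pz))
... | yes px | no ¬py | no ¬pz = inj₂ (inj₂ (neither ¬py ¬pz))
... | no ¬px | yes py | yes pz = inj₂ (inj₂ (both py pz))
... | no ¬px | yes py | no ¬pz = inj₂ (inj₁ (neither ¬px ¬pz))

n≤∣p∣ : ∀ {n} {p : Subset n} → (∀ x → x ∈ p) → n ≤ ∣ p ∣
n≤∣p∣ {n} {p} all∈p = subst (_≤ ∣ p ∣) (∣⊤∣≡n n) (p⊆q⇒∣p∣≤∣q∣ {p = ⊤} (λ {x} _ → all∈p x))

n≤1+∣p∣ : ∀ {n} (p : Subset n) → (∀ {x y} → x ∉ p → y ∉ p → x ≡ y) → n ≤ 1 + ∣ p ∣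
n≤1+∣p∣ []            _   = z≤n
n≤1+∣p∣ (inside  ∷ p) ∉⇒≡ = s≤s (n≤1+∣p∣ p λ x∉p y∉p →
  Fin-suc-injective (∉⇒≡ (x∉p ∘ drop-there) (y∉p ∘ drop-there)))
n≤1+∣p∣ (outside ∷ p) ∉⇒≡ = s≤s (n≤∣p∣ λ x → decidable-stable (x ∈? p) λ x∉p →
  0≢1+n (∉⇒≡ (λ ()) (x∉p ∘ drop-there)))

n≤2+∣p∣ : ∀ {n} (p : Subset n) →
          (∀ {x y z} → x ∉ p → y ∉ p → z ∉ p → x ≡ y ⊎ x ≡ z ⊎ y ≡ z) → n ≤ 2 + ∣ p ∣
n≤2+∣p∣ []            _   = z≤n
n≤2+∣p∣ (inside  ∷ p) ∉⇒≡ = s≤s (n≤2+∣p∣ p λ x∉p y∉p z∉p →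
  ⊎-map Fin-suc-injective (⊎-map Fin-suc-injective Fin-suc-injective)
    (∉⇒≡ (x∉p ∘ drop-there) (y∉p ∘ drop-there) (z∉p ∘ drop-there)))
n≤2+∣p∣ (outside ∷ p) ∉⇒≡ = s≤s (n≤1+∣p∣ p λ x∉p y∉p →
  case ∉⇒≡ {x = zero} (λ ()) (x∉p ∘ drop-there) (y∉p ∘ drop-there) of λ where
    (inj₂ (inj₂ sx≡sy)) → Fin-suc-injective sx≡sy
    (inj₁ ())
    (inj₂ (inj₁ ())))

IsUnit : (n : ℕ) → Fin n → Set
IsUnit n x = ∃ λ k → ∃ λ q → k * toℕ x ≡ q * n + 1

unit⇒generates : ∀ {n} (x : Fin n) → IsUnit n x → Generates n x
unit⇒generates {n} x (k , q , kx≡qn+1) y = k * toℕ y , q * toℕ y , (begin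
  k * toℕ y * toℕ x   ≡⟨ solve 3 (λ k y x → k :* y :* x := y :* (k :* x)) refl k (toℕ y) (toℕ x) ⟩
  toℕ y * (k * toℕ x) ≡⟨ cong (toℕ y *_) kx≡qn+1 ⟩
  toℕ y * (q * n + 1) ≡⟨ solve 3 (λ y q n → y :* (q :* n :+ con 1) := q :* y :* n :+ y) refl (toℕ y) q n ⟩
  q * toℕ y * n + toℕ y ∎)
  where
  open ≡-Reasoning
  open +-*-Solver

module GeneratorGraph (m : ℕ) where

  private
    N : ℕ
    N = suc (suc m)

  -- In the second case b·x ≡ −1, so (N − 1)·b·x ≡ (−1)² ≡ 1 (mod N).
  coprime⇒unit : (x : Fin N) → Coprime N (toℕ x) → IsUnit N x
  coprime⇒unit x coprime with coprime-Bézout coprime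
  ... | Bézout.-+ a b 1+aN≡bx = b , a , trans (sym 1+aN≡bx) (+-comm 1 (a * N))
  ... | Bézout.+- (suc a) b 1+bx≡[1+a]N = suc m * b , a + m * suc a , (begin
    suc m * b * toℕ x         ≡⟨ *-assoc (suc m) b (toℕ x) ⟩
    suc m * (b * toℕ x)       ≡⟨ cong (suc m *_) (ℕ-suc-injective 1+bx≡[1+a]N) ⟩
    suc m * (suc m + a * N)   ≡⟨ solve 2 (λ m a → (con 1 :+ m) :* ((con 1 :+ m) :+ a :* (con 2 :+ m))
                                          := (a :+ m :* (con 1 :+ a)) :* (con 2 :+ m) :+ con 1) refl m a ⟩
    (a + m * suc a) * N + 1   ∎)
    where
    open ≡-Reasoning
    open +-*-Solver

  generates⇒coprime : (x : Fin N) → Generates N x → Coprime N (toℕ x)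
  generates⇒coprime x generates {d} (d∣N , d∣x) with generates (suc zero)
  ... | k , q , kx≡qN+1 =
    ∣1⇒≡1 (∣m+n∣m⇒∣n (subst (d ∣_) kx≡qN+1 (∣-trans d∣x (n∣m*n k))) (∣-trans d∣N (n∣m*n q)))

  generates? : Decidable (Generates N)
  generates? x with coprime? N (toℕ x)
  ... | yes coprime  = yes (unit⇒generates x (coprime⇒unit x coprime))
  ... | no ¬coprime = no (¬coprime ∘ generates⇒coprime x)

  generates-1 : Generates N (suc zero)
  generates-1 y = toℕ y , 0 , *-identityʳ (toℕ y)

  ¬generates-0 : ¬ Generates N zero
  ¬generates-0 generates with generates (suc zero)
  ... | k , q , k*0≡qN+1 with trans (sym (*-zeroʳ k)) (trans k*0≡qN+1 (+-comm (q * N) 1))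
  ... | ()

  ¬adj⇒dist-2 : {u v : Fin N} → u ≢ v → ¬ Adj N u v → Dist N u v 2
  ¬adj⇒dist-2 {u} {v} u≢v u≁v = step u~1 (step 1~v here) , shortest
    where
    u~1 : Adj N u (suc zero)
    u~1 = (λ { refl → u≁v (u≢v , inj₁ generates-1) }) , inj₂ generates-1
    1~v : Adj N (suc zero) v
    1~v = (λ { refl → u≁v (u≢v , inj₂ generates-1) }) , inj₁ generates-1
    shortest : ∀ k → Walk N u v k → 2 ≤ k
    shortest zero          walk               = contradiction (walk₀⇒≡ walk) u≢v
    shortest (suc zero)    (step u~v here)    = contradiction u~v u≁v
    shortest (suc (suc k)) _                  = s≤s (s≤s z≤n)

  connected : Connected N
  connected u v with u ≟ v | generates? u | generates? v
  ... | yes refl | _ | _ = 0 , dist-refl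
  ... | no u≢v | yes gen-u | _         = 1 , adj⇒dist-1 (u≢v , inj₁ gen-u)
  ... | no u≢v | no _      | yes gen-v = 1 , adj⇒dist-1 (u≢v , inj₂ gen-v)
  ... | no u≢v | no ¬gen-u | no ¬gen-v = 2 , ¬adj⇒dist-2 u≢v ([ ¬gen-u , ¬gen-v ]′ ∘ proj₂)

  twin-pair-among-three : ∀ u v w → Twins N u v ⊎ Twins N u w ⊎ Twins N v w
  twin-pair-among-three = two-of-three generates? (Twins N)
    (λ gen-x gen-y → generates⇒Nbrs⊆ gen-y , generates⇒Nbrs⊆ gen-x)
    (λ ¬gen-x ¬gen-y → ¬generates⇒Nbrs⊆ ¬gen-x , ¬generates⇒Nbrs⊆ ¬gen-y)

  n∸2≤∣W∣ : (W : Subset N) → Resolving N W → N ∸ 2 ≤ ∣ W ∣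
  n∸2≤∣W∣ W resolving = m≤n+o⇒m∸n≤o N 2 (n≤2+∣p∣ W λ {u} {v} {w} u∉W v∉W w∉W →
    ⊎-map (λ twins → twins≡ twins u∉W v∉W)
          (⊎-map (λ twins → twins≡ twins u∉W w∉W) (λ twins → twins≡ twins v∉W w∉W))
          (twin-pair-among-three u v w))
    where
    twins≡ : ∀ {u v} → Twins N u v → u ∉ W → v ∉ W → u ≡ v
    twins≡ = resolving-twins-∉⇒≡ resolving

  prime⇒generates : Prime N → (x : Fin N) → x ≢ zero → Generates N x
  prime⇒generates _       zero    x≢0 = contradiction refl x≢0
  prime⇒generates N-prime (suc i) _   =
    unit⇒generates (suc i) (coprime⇒unit (suc i) (prime⇒coprime N-prime (toℕ<n (suc i))))

  prime⇒complete : Prime N → {u v : Fin N} → u ≢ v → Adj N u v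
  prime⇒complete N-prime {zero}  {v} u≢v = u≢v , inj₂ (prime⇒generates N-prime v (u≢v ∘ sym))
  prime⇒complete N-prime {suc i}     u≢v = u≢v , inj₁ (prime⇒generates N-prime (suc i) λ ())

  prime⇒n∸1≤∣W∣ : Prime N → (W : Subset N) → Resolving N W → N ∸ 1 ≤ ∣ W ∣
  prime⇒n∸1≤∣W∣ N-prime W resolving = m≤n+o⇒m∸n≤o N 1 (n≤1+∣p∣ W
    (resolving-twins-∉⇒≡ resolving (complete⇒Nbrs⊆ complete , complete⇒Nbrs⊆ complete)))
    where
    complete : ∀ {u v} → u ≢ v → Adj N u v
    complete = prime⇒complete N-prime

  proper-divisor⇒non-generator : ∀ d → .{{NonTrivial d}} → d < N → d ∣ N →
                                 ∃ λ j → ¬ Generates N (suc (suc j))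
  proper-divisor⇒non-generator (suc (suc e)) d<N d∣N = j , ¬generates
    where
    j : Fin m
    j = fromℕ< (s≤s⁻¹ (s≤s⁻¹ d<N))
    d∣j+2 : suc (suc e) ∣ suc (suc (toℕ j))
    d∣j+2 = subst (λ i → suc (suc e) ∣ suc (suc i)) (sym (toℕ-fromℕ< _)) ∣-refl
    ¬generates : ¬ Generates N (suc (suc j))
    ¬generates generates with generates⇒coprime (suc (suc j)) generates (d∣N , d∣j+2)
    ... | ()

  ¬prime⇒non-generator : ¬ Prime N → ∃ λ j → ¬ Generates N (suc (suc j))
  ¬prime⇒non-generator ¬prime with decidable-stable (composite? N) (¬prime ∘ ¬composite⇒prime)
  ... | composite {d} d<N d∣N = proper-divisor⇒non-generator d d<N d∣N

  outside∷outside∷⊤-resolving : ∀ j → ¬ Generates N (suc (suc j)) → Resolving N (outside ∷ outside ∷ ⊤)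
  outside∷outside∷⊤-resolving j ¬gen-c = resolving
    where
    c : Fin N
    c = suc (suc j)
    0-1-resolved : Resolves N (outside ∷ outside ∷ ⊤) zero (suc zero)
    0-1-resolved = c , there (there ∈⊤) , 2 , 1
                 , ¬adj⇒dist-2 (λ ()) ([ ¬generates-0 , ¬gen-c ]′ ∘ proj₂)
                 , adj⇒dist-1 ((λ ()) , inj₁ generates-1)
                 , λ ()
    resolving : Resolving N (outside ∷ outside ∷ ⊤)
    resolving (suc (suc i)) v             u≢v = member-resolves connected (there (there ∈⊤)) u≢v
    resolving u             (suc (suc i)) u≢v =
      resolves-sym (member-resolves connected (there (there ∈⊤)) (u≢v ∘ sym))
    resolving zero          (suc zero)    _   = 0-1-resolved
    resolving (suc zero)    zero          _   = resolves-sym 0-1-resolved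
    resolving zero          zero          u≢v = contradiction refl u≢v
    resolving (suc zero)    (suc zero)    u≢v = contradiction refl u≢v

corollary5p3 : (n : ℕ) → 2 ≤ n →
    (Prime n → MetricDim n (n ∸ 1)) × (¬ Prime n → MetricDim n (n ∸ 2))
corollary5p3 (suc (suc m)) _ =
  (λ N-prime → (outside ∷ ⊤ , outside∷⊤-resolving connected , ∣⊤∣≡n (suc m)) ,
               prime⇒n∸1≤∣W∣ N-prime) ,
  (λ ¬prime → let (j , ¬gen) = ¬prime⇒non-generator ¬prime in
    (outside ∷ outside ∷ ⊤ , outside∷outside∷⊤-resolving j ¬gen , ∣⊤∣≡n m) , n∸2≤∣W∣)
  where
  open GeneratorGraph m
corollary5p3 (suc zero) (s≤s ())
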